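{- Let $m \in \mathbf{N}$ and let $\Omega = \{\mathrm{H},\mathrm{T}\}^m$ be the probability space of $m$ flips of a fair coin, each $\omega = (\omega_1,\dots,\omega_m) \in \Omega$ having probability $2^{ -m}$. For $0 \le t \le m$ let $X_t$ be the number of heads among $\omega_1,\dots,\omega_t$ (so $X_0 = 0$), and for $1 \le t \le m$ define \[ C_t = \begin{cases} X_{t-1} & \text{if } \omega_t = \mathrm{T}, \\ 0 & \text{if } \omega_t = \mathrm{H}. \end{cases} \] If $1 \le t \le u \le m$, then $C_t$ and $X_u$ are uncorrelated, i.e. $\mathbf{E}[C_t X_u] = \mathbf{E}[C_t]\,\mathbf{E}[X_u]$. -}

module Defs where

open import Data.Bool using (Bool; true; false)
open import Data.Nat as ℕ using (ℕ; zero; suc; _+_; _*_; _^_)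
open import Data.Nat.Properties using (m^n≢0)
open import Data.Vec using (Vec; []; _∷_)
open import Data.List using (List; []; _∷_; map; _++_)
open import Data.Nat.ListAction using (sum)
open import Data.Integer using (+_)
open import Data.Rational using (ℚ; _/_)

-- Outcomes of m coin flips: true = H (heads), false = T (tails).
Ω : ℕ → Set
Ω m = Vec Bool m

outcomes : (m : ℕ) → List (Ω m)
outcomes zero    = [ [] ]
  where open import Data.List using ([_])
outcomes (suc m) = map (true ∷_) (outcomes m) ++ map (false ∷_) (outcomes m)

E : (m : ℕ) → (Ω m → ℕ) → ℚ
E m f = (+ sum (map f (outcomes m))) / (2 ^ m)
  where instance _ = m^n≢0 2 m

X : ∀ {m} → ℕ → Ω m → ℕ
X zero    _            = 0
X (suc t) []           = 0
X (suc t) (true  ∷ ω) = suc (X t ω)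
X (suc t) (false ∷ ω) = X t ω

-- ω_t, 1-indexed (t ≥ 1): is the t-th flip heads?
flip : ∀ {m} → ℕ → Ω m → Bool
flip _             []      = false
flip zero          (b ∷ _) = b   -- unused (t ≥ 1)
flip (suc zero)    (b ∷ _) = b
flip (suc (suc t)) (_ ∷ ω) = flip (suc t) ω

C : ∀ {m} → ℕ → Ω m → ℕ
C t ω with flip t ω
... | true  = 0
... | false = X (t ℕ.∸ 1) ω

-- Write T_s for the indicator that flip s+1 is tails, so that C_{s+1} = T_s X_s.  Splitting on
-- the first flip expresses the sums over Ω of X_u, T_s, T_s X_v and T_s X_s X_u through sums
-- of the same kind over one flip fewer; by induction they are 2^m u/2, 2^m/2, 2^m v/4 (or
-- 2^m (v−1)/4 once flip s+1 is counted by X_v) and 2^m s u/8, so E[C_{s+1} X_u] = s u/8 is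
-- (s/4)(u/2).  This is not independence: for u = s+1 the identity rests on Var X_s = s/4.
module Submission where

open import Defs
open import Function using (_∘_)
open import Data.Bool using (true; false; if_then_else_)
open import Data.Nat using (ℕ; zero; suc; _+_; _*_; _^_; _≤_; _<_; s≤s; NonZero)
open import Data.Nat.Properties
  using (m^n≢0; *-cancelˡ-≡; *-zeroʳ; *-identityˡ; *-suc; *-assoc; ≤-refl; ≤-<-trans; <-≤-trans;
         +-commutativeSemigroup)
open import Algebra.Properties.CommutativeSemigroup +-commutativeSemigroup using (interchange)
open import Data.Nat.Tactic.RingSolver using (solve-∀)
open import Data.List using (List; []; _∷_; map; _++_)
open import Data.List.Properties using (map-++; map-cong; map-∘)
open import Data.Nat.ListAction using (sum)
open import Data.Nat.ListAction.Properties using (sum-++)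
open import Data.Vec using (_∷_)
open import Data.Integer as ℤ using (+_)
open import Data.Integer.Properties using (pos-*)
open import Data.Rational using (_/_; toℚᵘ) renaming (_*_ to _*ℚ_)
open import Data.Rational.Properties using (toℚᵘ-injective; toℚᵘ-fromℚᵘ; toℚᵘ-homo-*)
open import Data.Rational.Unnormalised as ℚᵘ using (mkℚᵘ; *≡*) renaming (_≃_ to _≃ᵘ_)
open import Data.Rational.Unnormalised.Properties using (≃-trans; ≃-sym; *-cong)
open import Relation.Binary.PropositionalEquality
  using (_≡_; refl; sym; trans; cong; cong₂; _≗_; module ≡-Reasoning)

open ≡-Reasoning

sumΩ : (m : ℕ) → (Ω m → ℕ) → ℕ
sumΩ m f = sum (map f (outcomes m))

sumΩ-suc : ∀ m (f : Ω (suc m) → ℕ) →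
           sumΩ (suc m) f ≡ sumΩ m (f ∘ (true ∷_)) + sumΩ m (f ∘ (false ∷_))
sumΩ-suc m f = begin
  sum (map f (heads ++ tails))            ≡⟨ cong sum (map-++ f heads tails) ⟩
  sum (map f heads ++ map f tails)        ≡⟨ sum-++ (map f heads) (map f tails) ⟩
  sum (map f heads) + sum (map f tails)   ≡⟨ cong₂ _+_ (cong sum (sym (map-∘ (outcomes m))))
                                                       (cong sum (sym (map-∘ (outcomes m)))) ⟩
  sumΩ m (f ∘ (true ∷_)) + sumΩ m (f ∘ (false ∷_)) ∎
  where
  heads tails : List (Ω (suc m))
  heads = map (true ∷_) (outcomes m)
  tails = map (false ∷_) (outcomes m)

sumΩ-cong : ∀ m {f g : Ω m → ℕ} → f ≗ g → sumΩ m f ≡ sumΩ m g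
sumΩ-cong m f≗g = cong sum (map-cong f≗g (outcomes m))

sum-map-+ : ∀ {A : Set} (f g : A → ℕ) xs →
            sum (map (λ x → f x + g x) xs) ≡ sum (map f xs) + sum (map g xs)
sum-map-+ f g []       = refl
sum-map-+ f g (x ∷ xs) = begin
  f x + g x + sum (map (λ x → f x + g x) xs)       ≡⟨ cong (λ r → f x + g x + r) (sum-map-+ f g xs) ⟩
  f x + g x + (sum (map f xs) + sum (map g xs))    ≡⟨ interchange (f x) (g x) (sum (map f xs)) (sum (map g xs)) ⟩
  f x + sum (map f xs) + (g x + sum (map g xs))    ∎

sumΩ-+ : ∀ m (f g : Ω m → ℕ) → sumΩ m (λ ω → f ω + g ω) ≡ sumΩ m f + sumΩ m g
sumΩ-+ m f g = sum-map-+ f g (outcomes m)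

sumΩ-const : ∀ m k → sumΩ m (λ _ → k) ≡ 2 ^ m * k
sumΩ-const zero    k = refl
sumΩ-const (suc m) k = begin
  sumΩ (suc m) (λ _ → k)                   ≡⟨ sumΩ-suc m (λ _ → k) ⟩
  sumΩ m (λ _ → k) + sumΩ m (λ _ → k)      ≡⟨ cong₂ _+_ (sumΩ-const m k) (sumΩ-const m k) ⟩
  2 ^ m * k + 2 ^ m * k                    ≡⟨ double (2 ^ m) k ⟩
  2 ^ suc m * k                            ∎
  where
  double : ∀ n k → n * k + n * k ≡ 2 * n * k
  double = solve-∀

sumΩ-suc-split : ∀ m (f : Ω (suc m) → ℕ) (g h : Ω m → ℕ) →
                 (∀ ω → f (true ∷ ω) ≡ g ω + h ω) → (∀ ω → f (false ∷ ω) ≡ h ω) →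
                 sumΩ (suc m) f ≡ sumΩ m g + 2 * sumΩ m h
sumΩ-suc-split m f g h f-heads f-tails = begin
  sumΩ (suc m) f                                     ≡⟨ sumΩ-suc m f ⟩
  sumΩ m (f ∘ (true ∷_)) + sumΩ m (f ∘ (false ∷_))   ≡⟨ cong₂ _+_ (sumΩ-cong m f-heads) (sumΩ-cong m f-tails) ⟩
  sumΩ m (λ ω → g ω + h ω) + sumΩ m h                ≡⟨ cong (_+ sumΩ m h) (sumΩ-+ m g h) ⟩
  sumΩ m g + sumΩ m h + sumΩ m h                     ≡⟨ regroup (sumΩ m g) (sumΩ m h) ⟩
  sumΩ m g + 2 * sumΩ m h                            ∎
  where
  regroup : ∀ a b → a + b + b ≡ a + 2 * b
  regroup = solve-∀

tailsAt : ∀ {m} → ℕ → Ω m → ℕ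
tailsAt s ω = if flip (suc s) ω then 0 else 1

C≡tailsAt*X : ∀ {m} s (ω : Ω m) → C (suc s) ω ≡ tailsAt s ω * X s ω
C≡tailsAt*X s ω with flip (suc s) ω
... | true  = refl
... | false = sym (*-identityˡ (X s ω))

sumΩ-X : ∀ m u → u ≤ m → 2 * sumΩ m (X u) ≡ 2 ^ m * u
sumΩ-X m       zero    _          rewrite sumΩ-const m 0 | *-zeroʳ (2 ^ m) = refl
sumΩ-X (suc m) (suc u) (s≤s u≤m) = begin
  2 * sumΩ (suc m) (X (suc u))              ≡⟨ cong (2 *_) (sumΩ-suc-split m (X (suc u)) (λ _ → 1) (X u) (λ _ → refl) (λ _ → refl)) ⟩
  2 * (sumΩ m (λ _ → 1) + 2 * sumΩ m (X u)) ≡⟨ cong₂ (λ a b → 2 * (a + b)) (sumΩ-const m 1) (sumΩ-X m u u≤m) ⟩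
  2 * (2 ^ m * 1 + 2 ^ m * u)               ≡⟨ arith (2 ^ m) u ⟩
  2 ^ suc m * suc u                         ∎
  where
  arith : ∀ n u → 2 * (n * 1 + n * u) ≡ 2 * n * suc u
  arith = solve-∀

sumΩ-tailsAt : ∀ m s → s < m → 2 * sumΩ m (tailsAt s) ≡ 2 ^ m
sumΩ-tailsAt (suc m) zero    _         = begin
  2 * sumΩ (suc m) (tailsAt 0)              ≡⟨ cong (2 *_) (sumΩ-suc m (tailsAt 0)) ⟩
  2 * (sumΩ m (λ _ → 0) + sumΩ m (λ _ → 1)) ≡⟨ cong₂ (λ a b → 2 * (a + b)) (sumΩ-const m 0) (sumΩ-const m 1) ⟩
  2 * (2 ^ m * 0 + 2 ^ m * 1)               ≡⟨ arith (2 ^ m) ⟩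
  2 ^ suc m                                 ∎
  where
  arith : ∀ n → 2 * (n * 0 + n * 1) ≡ 2 * n
  arith = solve-∀
sumΩ-tailsAt (suc m) (suc s) (s≤s s<m) = begin
  2 * sumΩ (suc m) (tailsAt (suc s))            ≡⟨ cong (2 *_) (sumΩ-suc m (tailsAt (suc s))) ⟩
  2 * (sumΩ m (tailsAt s) + sumΩ m (tailsAt s)) ≡⟨ arith (sumΩ m (tailsAt s)) ⟩
  2 * (2 * sumΩ m (tailsAt s))                  ≡⟨ cong (2 *_) (sumΩ-tailsAt m s s<m) ⟩
  2 ^ suc m                                     ∎
  where
  arith : ∀ a → 2 * (a + a) ≡ 2 * (2 * a)
  arith = solve-∀

sumΩ-tailsAt*X-suc : ∀ m s v w → s < m →
                     4 * sumΩ m (λ ω → tailsAt s ω * X v ω) ≡ 2 ^ m * w →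
                     4 * sumΩ (suc m) (λ ω → tailsAt (suc s) ω * X (suc v) ω) ≡ 2 ^ suc m * suc w
sumΩ-tailsAt*X-suc m s v w s<m sum≡ = begin
  4 * sumΩ (suc m) (λ ω → tailsAt (suc s) ω * X (suc v) ω)
    ≡⟨ cong (4 *_) (sumΩ-suc-split m _ (tailsAt s) (λ ω → tailsAt s ω * X v ω)
                                     (λ ω → *-suc (tailsAt s ω) (X v ω)) (λ _ → refl)) ⟩
  4 * (sumΩ m (tailsAt s) + 2 * sumΩ m (λ ω → tailsAt s ω * X v ω))
    ≡⟨ regroup (sumΩ m (tailsAt s)) (sumΩ m (λ ω → tailsAt s ω * X v ω)) ⟩
  2 * (2 * sumΩ m (tailsAt s)) + 2 * (4 * sumΩ m (λ ω → tailsAt s ω * X v ω))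
    ≡⟨ cong₂ (λ a b → 2 * a + 2 * b) (sumΩ-tailsAt m s s<m) sum≡ ⟩
  2 * 2 ^ m + 2 * (2 ^ m * w)
    ≡⟨ arith (2 ^ m) w ⟩
  2 ^ suc m * suc w ∎
  where
  regroup : ∀ a b → 4 * (a + 2 * b) ≡ 2 * (2 * a) + 2 * (4 * b)
  regroup = solve-∀
  arith : ∀ n w → 2 * n + 2 * (n * w) ≡ 2 * n * suc w
  arith = solve-∀

sumΩ-tailsAt*X-before : ∀ m s v → v ≤ s → s < m →
                        4 * sumΩ m (λ ω → tailsAt s ω * X v ω) ≡ 2 ^ m * v
sumΩ-tailsAt*X-before m s zero _ _
  rewrite sumΩ-cong m (λ ω → *-zeroʳ (tailsAt s ω)) | sumΩ-const m 0 | *-zeroʳ (2 ^ m) = refl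
sumΩ-tailsAt*X-before (suc m) (suc s) (suc v) (s≤s v≤s) (s≤s s<m) =
  sumΩ-tailsAt*X-suc m s v v s<m (sumΩ-tailsAt*X-before m s v v≤s s<m)

sumΩ-tailsAt*X-through : ∀ m s v → s ≤ v → v < m →
                         4 * sumΩ m (λ ω → tailsAt s ω * X (suc v) ω) ≡ 2 ^ m * v
sumΩ-tailsAt*X-through (suc m) zero v _ (s≤s v≤m) = begin
  4 * sumΩ (suc m) (λ ω → tailsAt 0 ω * X (suc v) ω)
    ≡⟨ cong (4 *_) (sumΩ-suc m (λ ω → tailsAt 0 ω * X (suc v) ω)) ⟩
  4 * (sumΩ m (λ _ → 0) + sumΩ m (λ ω → 1 * X v ω))
    ≡⟨ cong₂ (λ a b → 4 * (a + b)) (sumΩ-const m 0) (sumΩ-cong m (λ ω → *-identityˡ (X v ω))) ⟩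
  4 * (2 ^ m * 0 + sumΩ m (X v))
    ≡⟨ regroup (2 ^ m) (sumΩ m (X v)) ⟩
  2 * (2 * sumΩ m (X v))
    ≡⟨ cong (2 *_) (sumΩ-X m v v≤m) ⟩
  2 * (2 ^ m * v)
    ≡⟨ *-assoc 2 (2 ^ m) v ⟨
  2 ^ suc m * v ∎
  where
  regroup : ∀ n a → 4 * (n * 0 + a) ≡ 2 * (2 * a)
  regroup = solve-∀
sumΩ-tailsAt*X-through (suc m) (suc s) (suc v) (s≤s s≤v) (s≤s v<m) =
  sumΩ-tailsAt*X-suc m s (suc v) v (≤-<-trans s≤v v<m) (sumΩ-tailsAt*X-through m s v s≤v v<m)

sumΩ-tailsAt*X*X : ∀ m s u → s < u → u ≤ m →
                   8 * sumΩ m (λ ω → tailsAt s ω * X s ω * X u ω) ≡ 2 ^ m * s * u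
sumΩ-tailsAt*X*X m zero u _ _
  rewrite sumΩ-cong m (λ ω → cong (_* X u ω) (*-zeroʳ (tailsAt 0 ω)))
        | sumΩ-const m 0 | *-zeroʳ (2 ^ m) = refl
sumΩ-tailsAt*X*X (suc m) (suc s) (suc (suc v)) (s≤s (s≤s s≤v)) (s≤s v<m) = begin
  8 * sumΩ (suc m) (λ ω → tailsAt (suc s) ω * X (suc s) ω * X (suc (suc v)) ω)
    ≡⟨ cong (8 *_) (sumΩ-suc-split m _ _ (λ ω → tailsAt s ω * X s ω * X (suc v) ω)
                                     (λ ω → expand (tailsAt s ω) (X s ω) (X (suc v) ω)) (λ _ → refl)) ⟩
  8 * (sumΩ m (λ ω → tailsAt s ω + tailsAt s ω * X s ω + tailsAt s ω * X (suc v) ω) + 2 * d)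
    ≡⟨ cong (λ e → 8 * (e + 2 * d)) linearity ⟩
  8 * (a + b + c + 2 * d)
    ≡⟨ regroup a b c d ⟩
  4 * (2 * a) + 2 * (4 * b) + 2 * (4 * c) + 2 * (8 * d)
    ≡⟨ cong₂ _+_ (cong₂ _+_ (cong₂ (λ x y → 4 * x + 2 * y)
                                   (sumΩ-tailsAt m s s<m)
                                   (sumΩ-tailsAt*X-before m s s ≤-refl s<m))
                            (cong (2 *_) (sumΩ-tailsAt*X-through m s v s≤v v<m)))
                 (cong (2 *_) (sumΩ-tailsAt*X*X m s (suc v) (s≤s s≤v) v<m)) ⟩
  4 * n + 2 * (n * s) + 2 * (n * v) + 2 * (n * s * suc v)
    ≡⟨ arith n s v ⟩
  2 ^ suc m * suc s * suc (suc v) ∎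
  where
  n a b c d : ℕ
  n = 2 ^ m
  a = sumΩ m (tailsAt s)
  b = sumΩ m (λ ω → tailsAt s ω * X s ω)
  c = sumΩ m (λ ω → tailsAt s ω * X (suc v) ω)
  d = sumΩ m (λ ω → tailsAt s ω * X s ω * X (suc v) ω)
  s<m : s < m
  s<m = ≤-<-trans s≤v v<m
  expand : ∀ t x y → t * suc x * suc y ≡ t + t * x + t * y + t * x * y
  expand = solve-∀
  linearity : sumΩ m (λ ω → tailsAt s ω + tailsAt s ω * X s ω + tailsAt s ω * X (suc v) ω) ≡ a + b + c
  linearity = trans (sumΩ-+ m (λ ω → tailsAt s ω + tailsAt s ω * X s ω) (λ ω → tailsAt s ω * X (suc v) ω))
                    (cong (_+ c) (sumΩ-+ m (tailsAt s) (λ ω → tailsAt s ω * X s ω)))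
  regroup : ∀ a b c d → 8 * (a + b + c + 2 * d) ≡ 4 * (2 * a) + 2 * (4 * b) + 2 * (4 * c) + 2 * (8 * d)
  regroup = solve-∀
  arith : ∀ n s v → 4 * n + 2 * (n * s) + 2 * (n * v) + 2 * (n * s * suc v) ≡ 2 * n * suc s * suc (suc v)
  arith = solve-∀

a/n≡b/n*c/n : ∀ a b c n .{{_ : NonZero n}} → a * n ≡ b * c → + a / n ≡ (+ b / n) *ℚ (+ c / n)
a/n≡b/n*c/n a b c n@(suc k) a*n≡b*c =
  toℚᵘ-injective (≃-trans lhs≃ (≃-trans (*≡* cross) (≃-sym rhs≃)))
  where
  lhs≃ : toℚᵘ (+ a / n) ≃ᵘ mkℚᵘ (+ a) k
  lhs≃ = toℚᵘ-fromℚᵘ (mkℚᵘ (+ a) k)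
  rhs≃ : toℚᵘ ((+ b / n) *ℚ (+ c / n)) ≃ᵘ mkℚᵘ (+ b) k ℚᵘ.* mkℚᵘ (+ c) k
  rhs≃ = ≃-trans (toℚᵘ-homo-* (+ b / n) (+ c / n))
                 (*-cong (toℚᵘ-fromℚᵘ (mkℚᵘ (+ b) k)) (toℚᵘ-fromℚᵘ (mkℚᵘ (+ c) k)))
  cross : + a ℤ.* + (n * n) ≡ (+ b ℤ.* + c) ℤ.* + n
  cross = begin
    + a ℤ.* + (n * n)     ≡⟨ pos-* a (n * n) ⟨
    + (a * (n * n))       ≡⟨ cong +_ (*-assoc a n n) ⟨
    + (a * n * n)         ≡⟨ cong (λ x → + (x * n)) a*n≡b*c ⟩
    + (b * c * n)         ≡⟨ pos-* (b * c) n ⟩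
    + (b * c) ℤ.* + n     ≡⟨ cong (ℤ._* + n) (pos-* b c) ⟩
    (+ b ℤ.* + c) ℤ.* + n ∎

lemma1 : (m t u : ℕ) → 1 ≤ t → t ≤ u → u ≤ m →
    E m (λ ω → C t ω * X u ω) ≡ E m (C t) *ℚ E m (X u)
lemma1 m (suc s) u _ s<u u≤m = a/n≡b/n*c/n a b c n {{m^n≢0 2 m}} (*-cancelˡ-≡ (a * n) (b * c) 8 (begin
  8 * (a * n)       ≡⟨ *-assoc 8 a n ⟨
  8 * a * n         ≡⟨ cong (_* n) 8a≡nsu ⟩
  n * s * u * n     ≡⟨ arith n s u ⟩
  (n * s) * (n * u) ≡⟨ cong₂ _*_ 4b≡ns 2c≡nu ⟨
  (4 * b) * (2 * c) ≡⟨ regroup b c ⟩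
  8 * (b * c)       ∎))
  where
  n a b c : ℕ
  n = 2 ^ m
  a = sumΩ m (λ ω → C (suc s) ω * X u ω)
  b = sumΩ m (C (suc s))
  c = sumΩ m (X u)
  8a≡nsu : 8 * a ≡ n * s * u
  8a≡nsu = trans (cong (8 *_) (sumΩ-cong m (λ ω → cong (_* X u ω) (C≡tailsAt*X s ω))))
                 (sumΩ-tailsAt*X*X m s u s<u u≤m)
  4b≡ns : 4 * b ≡ n * s
  4b≡ns = trans (cong (4 *_) (sumΩ-cong m (C≡tailsAt*X s)))
                (sumΩ-tailsAt*X-before m s s ≤-refl (<-≤-trans s<u u≤m))
  2c≡nu : 2 * c ≡ n * u
  2c≡nu = sumΩ-X m u u≤m
  arith : ∀ n s u → n * s * u * n ≡ (n * s) * (n * u)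
  arith = solve-∀
  regroup : ∀ b c → (4 * b) * (2 * c) ≡ 8 * (b * c)
  regroup = solve-∀
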